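{- Let $\mathbf{w}$ be an infinite word over a finite alphabet and let $\varphi=(1+\sqrt5)/2$ be the golden ratio. The following are equivalent: (1) $\mathbf{w}$ is ultimately periodic; (2) $\operatorname{nsc}_{\mathbf{w}}(n)$ is bounded (as a function of $n$); (3) $\limsup_{n\to\infty} \operatorname{nsc}_{\mathbf{w}}(n)/n = 0$; (4) $\limsup_{n\to\infty} \operatorname{nsc}_{\mathbf{w}}(n)/n < \frac{1}{1+\varphi^2}$.
   Context: For an infinite word $\mathbf{x}=x_0x_1x_2\cdots$ (indexed from $0$) and an integer $n\ge 1$, the initial non-repetitive complexity is $\operatorname{nsc}_{\mathbf{x}}(n)=\max\{m\in\mathbb{N}: x_i\cdots x_{i+n-1}\neq x_j\cdots x_{j+n-1}\text{ for every } i,j \text{ with } 0\le i<j\le m-1\}$, i.e. the number of length-$n$ factors read from the left before the first repeated length-$n$ factor. An infinite word is ultimately periodic if it has the form $uvvv\cdots$ for finite words $u$ and nonempty $v$. -}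

module Defs where

open import Data.Nat using (ℕ; zero; suc; _+_; _*_; _∸_; _^_; _≤_; _<_)
open import Data.Fin using (Fin)
open import Data.Product using (Σ; ∃; ∃-syntax; _×_; _,_)
open import Relation.Nullary using (¬_)
open import Relation.Binary.PropositionalEquality using (_≡_)

Word : ℕ → Set
Word k = ℕ → Fin k

SameFactor : ∀ {k} → Word k → ℕ → ℕ → ℕ → Set
SameFactor x n i j = ∀ t → t < n → x (i + t) ≡ x (j + t)

DistinctPrefixFactors : ∀ {k} → Word k → ℕ → ℕ → Set
DistinctPrefixFactors x n m = ∀ i j → i < j → j < m → ¬ SameFactor x n i j

IsNsc : ∀ {k} → Word k → ℕ → ℕ → Set
IsNsc x n m = DistinctPrefixFactors x n m
            × (∀ m′ → DistinctPrefixFactors x n m′ → m′ ≤ m)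

-- Ultimately periodic: x = u v v v ⋯ with v nonempty, i.e. there are
-- a preperiod N = |u| and a period p = |v| ≥ 1 with x_{i+p} = x_i for all i ≥ N.
UltimatelyPeriodic : ∀ {k} → Word k → Set
UltimatelyPeriodic x = ∃[ p ] ∃[ N ] (1 ≤ p × (∀ i → N ≤ i → x (i + p) ≡ x i))

NscBounded : ∀ {k} → Word k → Set
NscBounded x = ∃[ B ] (∀ n m → 1 ≤ n → IsNsc x n m → m ≤ B)

EventuallyRatioLE : ∀ {k} → Word k → ℕ → ℕ → Set
EventuallyRatioLE x p q = ∃[ N ] (∀ n m → N ≤ n → 1 ≤ n → IsNsc x n m → q * m ≤ p * n)

-- (3) limsup_{n→∞} nsc_x(n)/n = 0, i.e. for every ε > 0 eventually
-- nsc_x(n)/n ≤ ε; here ε ranges over the positive rationals p/q.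
LimsupZero : ∀ {k} → Word k → Set
LimsupZero x = ∀ p q → 1 ≤ p → 1 ≤ q → EventuallyRatioLE x p q

-- The rational p/q (q ≥ 1) is strictly below 1/(1+φ²) = (5 - √5)/10,
-- where φ = (1+√5)/2 (so 1 + φ² = (5+√5)/2).
-- p/q < (5-√5)/10  ⇔  q√5 < 5q - 10p  ⇔  10p < 5q  and  5q² < (5q - 10p)².
BelowInvOnePlusPhiSq : ℕ → ℕ → Set
BelowInvOnePlusPhiSq p q =
  1 ≤ q × 10 * p < 5 * q × 5 * (q ^ 2) < (5 * q ∸ 10 * p) ^ 2

-- (4) limsup_{n→∞} nsc_x(n)/n < 1/(1+φ²), i.e. there is a rational
-- p/q < 1/(1+φ²) with nsc_x(n)/n ≤ p/q for all sufficiently large n.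
LimsupBelowInvOnePlusPhiSq : ∀ {k} → Word k → Set
LimsupBelowInvOnePlusPhiSq x =
  ∃[ p ] ∃[ q ] (BelowInvOnePlusPhiSq p q × EventuallyRatioLE x p q)

module Submission where

-- The cycle (1) ⇒ (2) ⇒ (3) ⇒ (4) ⇒ (1) is proved.  The first three steps
-- are elementary: a period p after position N makes the factors at N and N+p
-- equal, so nsc(n) ≤ N + p; a bounded nsc has limsup 0; and 1/10 is a
-- rational below 1/(1+φ²).  All the work is in (4) ⇒ (1), where in fact
-- only the weaker bound limsup nsc(n)/n < 1/2 is used:
--   * nsc(n) < n/2 yields a "short repetition": equal factors of length n at
--     i and i+d with 2(i+d) < n, i.e. a period d on [i, i+d+n);
--   * a period-transfer lemma: if w has period d on an interval and period
--     P on a subinterval of length d+P, then P is a period on the whole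
--     interval (shift any position by multiples of d into the subinterval);
--   * starting from the short repetition at a fixed length N, the transfer
--     lemma extends its period P one position at a time, using the short
--     repetition at every later length, so w is P-periodic from some point.
-- The value nsc(n) itself exists by pigeonhole (there are at most k^n factors
-- of length n) together with excluded middle.

open import Defs
open import Data.Nat using (ℕ)
open import Data.Product using (_×_)
open import Function.Bundles using (_⇔_)
open import Level using (0ℓ)
open import Axiom.ExcludedMiddle using (ExcludedMiddle)

open import Data.Nat using (zero; suc; _+_; _*_; _^_; _⊔_; _≤_; _<_; z≤n; s≤s; s≤s⁻¹; _≤?_; _<?_)
open import Data.Nat.Properties
open import Data.Nat.Induction using (<-rec)
open import Data.Nat.Tactic.RingSolver using (solve-∀)
open import Data.Fin using (Fin; toℕ; fromℕ<; funToFin; finToFun)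
import Data.Fin.Properties as FinProps
open import Data.Product using (∃-syntax; _,_)
open import Data.Empty using (⊥-elim)
open import Relation.Nullary using (yes; no; contradiction)
open import Relation.Nullary.Decidable using (toWitness)
open import Relation.Binary.PropositionalEquality
open import Function.Base using (_∘′_)
open import Function.Bundles using (mk⇔)

halves-sum : ∀ u v {n} → 2 * u < n → 2 * v ≤ n → u + v < n
halves-sum u v {n} 2u<n 2v≤n = *-cancelˡ-< 2 (u + v) n (begin-strict
    2 * (u + v)   ≡⟨ *-distribˡ-+ 2 u v ⟩
    2 * u + 2 * v <⟨ +-mono-<-≤ 2u<n 2v≤n ⟩
    n + n         ≡⟨ cong (n +_) (sym (+-identityʳ n)) ⟩
    2 * n         ∎)
  where open ≤-Reasoning

ratio-below-half : ∀ p q {n m} → 2 * p < q → 1 ≤ n → q * m ≤ p * n → 2 * m < n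
ratio-below-half p q {n} {m} 2p<q (s≤s _) qm≤pn = *-cancelˡ-< q (2 * m) n (begin-strict
    q * (2 * m) ≡⟨ *-comm q (2 * m) ⟩
    2 * m * q   ≡⟨ *-assoc 2 m q ⟩
    2 * (m * q) ≡⟨ cong (2 *_) (*-comm m q) ⟩
    2 * (q * m) ≤⟨ *-monoʳ-≤ 2 qm≤pn ⟩
    2 * (p * n) ≡⟨ *-assoc 2 p n ⟨
    2 * p * n   <⟨ *-monoˡ-< n 2p<q ⟩
    q * n       ∎)
  where open ≤-Reasoning

HasPeriod : ∀ {k} → Word k → ℕ → ℕ → ℕ → Set
HasPeriod w p s e = ∀ x → s ≤ x → x + p < e → w (x + p) ≡ w x

module _ {k : ℕ} (w : Word k) where

  hasPeriod-restrict : ∀ {p s e s′ e′} →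
    HasPeriod w p s e → s ≤ s′ → e′ ≤ e → HasPeriod w p s′ e′
  hasPeriod-restrict per s≤s′ e′≤e x s′≤x x+p<e′ =
    per x (≤-trans s≤s′ s′≤x) (<-≤-trans x+p<e′ e′≤e)

  hasPeriod-glue : ∀ {P a b e e′} →
    HasPeriod w P a e → HasPeriod w P b e′ → b + P ≤ e → HasPeriod w P a e′
  hasPeriod-glue {P} {a} {b} {e} left right b+P≤e x a≤x x+P<e′ with x + P <? e
  ... | yes x+P<e = left x a≤x x+P<e
  ... | no x+P≮e = right x (+-cancelʳ-≤ P b x (≤-trans b+P≤e (≮⇒≥ x+P≮e))) x+P<e′

  sameFactor⇒hasPeriod : ∀ n i d → SameFactor w n i (i + d) → HasPeriod w d i (i + d + n)
  sameFactor⇒hasPeriod n i d same x i≤x x+d<e with m≤n⇒∃[o]m+o≡n i≤x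
  ... | o , refl = begin
        w (i + o + d) ≡⟨ cong w (swap i o d) ⟩
        w (i + d + o) ≡⟨ sym (same o o<n) ⟩
        w (i + o)     ∎
    where
    open ≡-Reasoning
    swap : ∀ i o d → i + o + d ≡ i + d + o
    swap = solve-∀
    o<n : o < n
    o<n = +-cancelˡ-< (i + d) o n (subst (_< i + d + n) (swap i o d) x+d<e)

  -- Let w have period d ≥ 1 on [s, e) and period P on the
  -- window [s₀, s₀+d+P) ⊆ [s, e).  The relation w (x+P) = w x is invariant
  -- under x ↦ x + d inside [s, e), and every x is congruent mod d to a point
  -- of [s₀, s₀+d), where it holds; hence P is a period of [s, e).
  module Transfer {d P s s₀ e : ℕ} (1≤d : 1 ≤ d) (period-d : HasPeriod w d s e)
                  (window : HasPeriod w P s₀ (s₀ + d + P))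
                  (s≤s₀ : s ≤ s₀) (window≤e : s₀ + d + P ≤ e) where

    PeriodAt : ℕ → Set
    PeriodAt x = w (x + P) ≡ w x

    period-d-at : ∀ x → s ≤ x → x + d + P < e → w (x + d) ≡ w x
    period-d-at x s≤x x+d+P<e = period-d x s≤x (≤-<-trans (m≤m+n (x + d) P) x+d+P<e)

    period-d-after : ∀ x → s ≤ x → x + d + P < e → w (x + d + P) ≡ w (x + P)
    period-d-after x s≤x x+d+P<e =
      trans (cong w (reorder x)) (period-d (x + P) (≤-trans s≤x (m≤m+n x P))
                                   (subst (_< e) (reorder x) x+d+P<e))
      where
      reorder : ∀ x → x + d + P ≡ x + P + d
      reorder x = trans (+-assoc x d P) (trans (cong (x +_) (+-comm d P)) (sym (+-assoc x P d)))

    shift-up : ∀ x → s ≤ x → x + d + P < e → PeriodAt x → PeriodAt (x + d)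
    shift-up x s≤x x+d+P<e at-x = begin
        w (x + d + P) ≡⟨ period-d-after x s≤x x+d+P<e ⟩
        w (x + P)     ≡⟨ at-x ⟩
        w x           ≡⟨ period-d-at x s≤x x+d+P<e ⟨
        w (x + d)     ∎
      where open ≡-Reasoning

    shift-down : ∀ x → s ≤ x → x + d + P < e → PeriodAt (x + d) → PeriodAt x
    shift-down x s≤x x+d+P<e at-x+d = begin
        w (x + P)     ≡⟨ period-d-after x s≤x x+d+P<e ⟨
        w (x + d + P) ≡⟨ at-x+d ⟩
        w (x + d)     ≡⟨ period-d-at x s≤x x+d+P<e ⟩
        w x           ∎
      where open ≡-Reasoning

    from-window : ∀ o → s₀ + o + P < e → PeriodAt (s₀ + o)
    from-window = <-rec (λ o → s₀ + o + P < e → PeriodAt (s₀ + o)) step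
      where
      step : ∀ o → (∀ {r} → r < o → s₀ + r + P < e → PeriodAt (s₀ + r)) →
             s₀ + o + P < e → PeriodAt (s₀ + o)
      step o rec in-range with o <? d
      ... | yes o<d = window (s₀ + o) (m≤m+n s₀ o) (+-monoˡ-< P (+-monoʳ-< s₀ o<d))
      ... | no o≮d with m≤n⇒∃[o]m+o≡n (≮⇒≥ o≮d)
      ...   | r , refl = subst PeriodAt (regroup s₀ r d)
                  (shift-up (s₀ + r) (≤-trans s≤s₀ (m≤m+n s₀ r)) r-range
                    (rec (m<n+m r 1≤d) (≤-<-trans (+-monoˡ-≤ P (m≤m+n _ d)) r-range)))
        where
        regroup : ∀ s₀ r d → s₀ + r + d ≡ s₀ + (d + r)
        regroup = solve-∀
        r-range : s₀ + r + d + P < e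
        r-range = subst (λ y → y + P < e) (sym (regroup s₀ r d)) in-range

    before-window : ∀ f x → s ≤ x → s₀ ≤ x + f → x + P < e → PeriodAt x
    before-window f x s≤x s₀≤x+f x+P<e with s₀ ≤? x
    ... | yes s₀≤x with m≤n⇒∃[o]m+o≡n s₀≤x
    ...   | o , refl = from-window o x+P<e
    before-window zero x s≤x s₀≤x+0 x+P<e | no s₀≰x =
      contradiction (subst (s₀ ≤_) (+-identityʳ x) s₀≤x+0) s₀≰x
    before-window (suc f) x s≤x s₀≤x+f x+P<e | no s₀≰x =
      shift-down x s≤x x+d+P<e
        (before-window f (x + d) (≤-trans s≤x (m≤m+n x d)) gap x+d+P<e)
      where
      x+d+P<e : x + d + P < e
      x+d+P<e = <-≤-trans (+-monoˡ-< P (+-monoˡ-< d (≰⇒> s₀≰x))) window≤e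
      gap : s₀ ≤ x + d + f
      gap = ≤-trans s₀≤x+f (≤-trans (+-monoʳ-≤ x (+-monoˡ-≤ f 1≤d))
                                    (≤-reflexive (sym (+-assoc x d f))))

    transfer : HasPeriod w P s e
    transfer x s≤x = before-window s₀ x s≤x (m≤n+m s₀ x)

  ShortRepetition : ℕ → Set
  ShortRepetition n = ∃[ i ] ∃[ d ] (1 ≤ d × 2 * (i + d) < n × SameFactor w n i (i + d))

  -- One extension step: a period P of [a, n) with 2(a+P) < n survives one more
  -- position when there is a short repetition of length n+1.  Its period d is
  -- valid on [i, i+d+n+1), which overlaps [a, n) in the window
  -- [a ⊔ i, a ⊔ i + d + P); transfer P to [i, i+d+n+1) and glue.
  extend-period : ∀ {P a n} → HasPeriod w P a n → 2 * (a + P) < n →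
                  ShortRepetition (suc n) → HasPeriod w P a (suc n)
  extend-period {P} {a} {n} per-a 2[a+P]<n (i , d , 1≤d , 2[i+d]<1+n , same) =
    hasPeriod-restrict
      (hasPeriod-glue per-a period-P-on-i (≤-trans i+P≤i+d+P (<⇒≤ i+d+P<n)))
      ≤-refl (m≤n+m (suc n) (i + d))
    where
    2[i+d]≤n : 2 * (i + d) ≤ n
    2[i+d]≤n = s≤s⁻¹ 2[i+d]<1+n
    a+d+P<n : a + d + P < n
    a+d+P<n = subst (_< n) (reorder a P d)
      (halves-sum (a + P) d 2[a+P]<n (≤-trans (*-monoʳ-≤ 2 (m≤n+m d i)) 2[i+d]≤n))
      where
      reorder : ∀ a P d → a + P + d ≡ a + d + P
      reorder = solve-∀
    i+d+P<n : i + d + P < n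
    i+d+P<n = subst (_< n) (+-comm P (i + d))
      (halves-sum P (i + d) (≤-<-trans (*-monoʳ-≤ 2 (m≤n+m P a)) 2[a+P]<n) 2[i+d]≤n)
    i+P≤i+d+P : i + P ≤ i + d + P
    i+P≤i+d+P = +-monoˡ-≤ P (m≤m+n i d)
    window≤n : a ⊔ i + d + P ≤ n
    window≤n = subst (_≤ n) (sym (trans (cong (_+ P) (+-distribʳ-⊔ d a i))
                                        (+-distribʳ-⊔ P (a + d) (i + d))))
                 (⊔-lub (<⇒≤ a+d+P<n) (<⇒≤ i+d+P<n))
    period-P-on-i : HasPeriod w P i (i + d + suc n)
    period-P-on-i = Transfer.transfer 1≤d (sameFactor⇒hasPeriod (suc n) i d same)
      (hasPeriod-restrict per-a (m≤m⊔n a i) window≤n)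
      (m≤n⊔m a i) (≤-trans window≤n (≤-trans (n≤1+n n) (m≤n+m (suc n) (i + d))))

  -- If short repetitions occur at every length n ≥ N, then w is ultimately
  -- periodic: the repetition at length N gives a period P on [a, N), which
  -- extend-period propagates to [a, N + t) for every t.
  shortRepetitions⇒ultimatelyPeriodic : ∀ N → (∀ n → N ≤ n → ShortRepetition n) →
                                        UltimatelyPeriodic w
  shortRepetitions⇒ultimatelyPeriodic N short
    with (a , P , 1≤P , 2[a+P]<N , same) ← short N ≤-refl =
    P , a , 1≤P , λ x a≤x → periodic-upto (suc (x + P)) x a≤x (m≤n+m (suc (x + P)) N)
    where
    periodic-upto : ∀ t → HasPeriod w P a (N + t)
    periodic-upto zero = hasPeriod-restrict (sameFactor⇒hasPeriod N a P same) ≤-refl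
                           (subst (_≤ a + P + N) (sym (+-identityʳ N)) (m≤n+m N (a + P)))
    periodic-upto (suc t) = subst (HasPeriod w P a) (sym (+-suc N t))
      (extend-period (periodic-upto t) (<-≤-trans 2[a+P]<N (m≤m+n N t))
                     (short (suc (N + t)) (≤-trans (m≤m+n N t) (n≤1+n (N + t)))))

  factorCode : (n : ℕ) → ℕ → Fin (k ^ n)
  factorCode n i = funToFin (λ (t : Fin n) → w (i + toℕ t))

  sameCode⇒sameFactor : ∀ n i j → factorCode n i ≡ factorCode n j → SameFactor w n i j
  sameCode⇒sameFactor n i j same-code t t<n = begin
      w (i + t)                          ≡⟨ cong (λ u → w (i + u)) (sym (FinProps.toℕ-fromℕ< t<n)) ⟩
      w (i + toℕ t′)                     ≡⟨ sym (FinProps.finToFun-funToFin (factorAt i) t′) ⟩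
      finToFun (factorCode n i) t′       ≡⟨ cong (λ c → finToFun c t′) same-code ⟩
      finToFun (factorCode n j) t′       ≡⟨ FinProps.finToFun-funToFin (factorAt j) t′ ⟩
      w (j + toℕ t′)                     ≡⟨ cong (λ u → w (j + u)) (FinProps.toℕ-fromℕ< t<n) ⟩
      w (j + t)                          ∎
    where
    open ≡-Reasoning
    t′ : Fin n
    t′ = fromℕ< t<n
    factorAt : ℕ → Fin n → Fin k
    factorAt i t = w (i + toℕ t)

  distinct⇒≤k^n : ∀ n m → DistinctPrefixFactors w n m → m ≤ k ^ n
  distinct⇒≤k^n n m distinct with m ≤? k ^ n
  ... | yes m≤k^n = m≤k^n
  ... | no m≰k^n
    with (a , b , a<b , same-code) ← FinProps.pigeonhole (n<1+n (k ^ n)) (factorCode n ∘′ toℕ) =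
    ⊥-elim (distinct (toℕ a) (toℕ b) a<b (<-≤-trans (FinProps.toℕ<n b) (≰⇒> m≰k^n))
                     (sameCode⇒sameFactor n (toℕ a) (toℕ b) same-code))

-- Classically, a predicate that holds at 0 and is bounded by B has a
-- greatest element; this is how nsc_w(n) is shown to exist.
greatest : ExcludedMiddle 0ℓ → (Q : ℕ → Set) → Q 0 → ∀ B → (∀ m → Q m → m ≤ B) →
           ∃[ m ] (Q m × (∀ m′ → Q m′ → m′ ≤ m))
greatest em Q Q0 zero    bounded = 0 , Q0 , bounded
greatest em Q Q0 (suc B) bounded with em {Q (suc B)}
... | yes Q[1+B] = suc B , Q[1+B] , bounded
... | no ¬Q[1+B] = greatest em Q Q0 B λ m Qm →
      s≤s⁻¹ (≤∧≢⇒< (bounded m Qm) λ { refl → ¬Q[1+B] Qm })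

module _ (em : ExcludedMiddle 0ℓ) {k : ℕ} (w : Word k) where

  -- nsc_w(n) exists: the empty prefix has no repeated factor, and pigeonhole
  -- bounds every prefix without repetitions.
  nsc-exists : ∀ n → ∃[ m ] IsNsc w n m
  nsc-exists n = greatest em (DistinctPrefixFactors w n)
    (λ i j i<j j<0 → contradiction j<0 λ ()) (k ^ n) (distinct⇒≤k^n w n)

  first-repetition : ∀ {n m} → IsNsc w n m →
                     ∃[ i ] ∃[ d ] (1 ≤ d × i + d ≤ m × SameFactor w n i (i + d))
  first-repetition {n} {m} (_ , maximal)
    with em {∃[ i ] ∃[ j ] (i < j × j ≤ m × SameFactor w n i j)}
  ... | no no-repeat = contradiction
        (maximal (suc m) λ i j i<j j<1+m same → no-repeat (i , j , i<j , s≤s⁻¹ j<1+m , same))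
        (<-irrefl refl)
  ... | yes (i , j , i<j , j≤m , same) with m≤n⇒∃[o]m+o≡n i<j
  ...   | o , refl = i , suc o , s≤s z≤n , subst (_≤ m) (sym (+-suc i o)) j≤m
                   , subst (SameFactor w n i) (sym (+-suc i o)) same

  below-half⇒shortRepetition : ∀ {n m} → 2 * m < n → IsNsc w n m → ShortRepetition w n
  below-half⇒shortRepetition 2m<n nsc
    with (i , d , 1≤d , i+d≤m , same) ← first-repetition nsc =
    i , d , 1≤d , ≤-<-trans (*-monoʳ-≤ 2 i+d≤m) 2m<n , same

  -- (4) ⇒ (1): only 10p < 5q, i.e. p/q < 1/2, is needed.  Eventually
  -- nsc_w(n) < n/2, which gives short repetitions at all large lengths.
  belowBound⇒periodic : LimsupBelowInvOnePlusPhiSq w → UltimatelyPeriodic w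
  belowBound⇒periodic (p , q , (_ , 10p<5q , _) , N , eventually) =
    shortRepetitions⇒ultimatelyPeriodic w (N ⊔ 1) λ n N⊔1≤n →
      let 1≤n = m⊔n≤o⇒n≤o N 1 N⊔1≤n
          (m , nsc) = nsc-exists n
      in below-half⇒shortRepetition
           (ratio-below-half p q 2p<q 1≤n (eventually n m (m⊔n≤o⇒m≤o N 1 N⊔1≤n) 1≤n nsc)) nsc
    where
    2p<q : 2 * p < q
    2p<q = *-cancelˡ-< 5 (2 * p) q (subst (_< 5 * q) (*-assoc 5 2 p) 10p<5q)

module _ {k : ℕ} (w : Word k) where

  -- (1) ⇒ (2): with period p from N on, the factors at N and N + p agree,
  -- so nsc_w(n) ≤ N + p for every n.
  periodic⇒bounded : UltimatelyPeriodic w → NscBounded w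
  periodic⇒bounded (p , N , 1≤p , periodic) = N + p , bound
    where
    repeat : ∀ n → SameFactor w n N (N + p)
    repeat n t _ = trans (sym (periodic (N + t) (m≤m+n N t))) (cong w (reorder N t p))
      where
      reorder : ∀ N t p → N + t + p ≡ N + p + t
      reorder = solve-∀
    bound : ∀ n m → 1 ≤ n → IsNsc w n m → m ≤ N + p
    bound n m _ (distinct , _) with m ≤? N + p
    ... | yes m≤N+p = m≤N+p
    ... | no m≰N+p = ⊥-elim (distinct N (N + p) (m<m+n N 1≤p) (≰⇒> m≰N+p) (repeat n))

  bounded⇒limsupZero : NscBounded w → LimsupZero w
  bounded⇒limsupZero (B , bounded) p q (s≤s _) _ = q * B , λ n m qB≤n 1≤n nsc → begin
      q * m ≤⟨ *-monoʳ-≤ q (bounded n m 1≤n nsc) ⟩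
      q * B ≤⟨ qB≤n ⟩
      n     ≤⟨ m≤m*n n p ⟩
      n * p ≡⟨ *-comm n p ⟩
      p * n ∎
    where open ≤-Reasoning

  limsupZero⇒belowBound : LimsupZero w → LimsupBelowInvOnePlusPhiSq w
  limsupZero⇒belowBound limsup-zero =
    1 , 10 , (s≤s z≤n , toWitness {a? = 11 ≤? 50} _ , toWitness {a? = 501 ≤? 1600} _) ,
    limsup-zero 1 10 (s≤s z≤n) (s≤s z≤n)

mainTheorem1 : ExcludedMiddle 0ℓ → {k : ℕ} → (w : Word k) →
    (UltimatelyPeriodic w ⇔ NscBounded w)
    × (UltimatelyPeriodic w ⇔ LimsupZero w)
    × (UltimatelyPeriodic w ⇔ LimsupBelowInvOnePlusPhiSq w)
mainTheorem1 em w =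
    mk⇔ (1⇒2) (4⇒1 ∘′ 3⇒4 ∘′ 2⇒3)
  , mk⇔ (2⇒3 ∘′ 1⇒2) (4⇒1 ∘′ 3⇒4)
  , mk⇔ (3⇒4 ∘′ 2⇒3 ∘′ 1⇒2) 4⇒1
  where
  1⇒2 : UltimatelyPeriodic w → NscBounded w
  1⇒2 = periodic⇒bounded w
  2⇒3 : NscBounded w → LimsupZero w
  2⇒3 = bounded⇒limsupZero w
  3⇒4 : LimsupZero w → LimsupBelowInvOnePlusPhiSq w
  3⇒4 = limsupZero⇒belowBound w
  4⇒1 : LimsupBelowInvOnePlusPhiSq w → UltimatelyPeriodic w
  4⇒1 = belowBound⇒periodic em w
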